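{- For all $i,j\in[1,2r+1]$, $$\{\gamma_i,\gamma_j\}=\epsilon_{ij}\,\gamma_i\gamma_j,\qquad \epsilon_{ij}=\begin{cases}1,& i<j\text{ and } i\sim j,\\ -1,& i>j\text{ and } i\sim j,\\ 0,&\text{otherwise},\end{cases}$$ where $i\sim j$ means that $i$ and $j$ are adjacent in $G_r$.
   Context: Fix $r\ge1$ and let $C$ be the Cartan matrix of type $A_r$ ($C_{aa}=2$, $C_{a,a\pm1}=-1$, other entries $0$). On Laurent polynomials in $A_1,\dots,A_{2r}$ define the Poisson bracket (bilinear, Leibniz) by $\{A_i,A_j\}=\Omega_{ij}A_iA_j$, where $\Omega=\begin{bmatrix}0&C^{ -1}\\-C^{ -1}&0\end{bmatrix}$ in $r\times r$ blocks. Write $q_a=A_a$, $p_a=A_{r+a}$ for $a\in[1,r]$ and $q_0=q_{r+1}=p_0=p_{r+1}=1$, and set $\gamma_{2a-1}=\dfrac{q_{a-1}p_a}{q_ap_{a-1}}$ ($a\in[1,r+1]$), $\gamma_{2a}=\dfrac{q_{a-1}p_{a+1}}{q_ap_a}$ ($a\in[1,r]$). $G_r$ is the graph with vertex set $[1,2r+1]$ and edges $\{i,i+1\}$ for $i\in[1,2r]$ and $\{2a,2a+2\}$ for $a\in[1,r-1]$. -}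

module Defs where

open import Level using (Level; _⊔_; suc)
open import Data.Nat as ℕ using (ℕ; zero)
import Data.Nat.Properties as ℕP
open import Data.Fin using (Fin; toℕ; fromℕ<; splitAt; _↑ˡ_; _↑ʳ_)
open import Data.Bool using (Bool; true; false; if_then_else_)
open import Data.Sum using (_⊎_; inj₁; inj₂)
open import Data.Rational as ℚ using (ℚ; 0ℚ; 1ℚ)
open import Relation.Nullary using (yes; no)
open import Relation.Binary.PropositionalEquality using (_≡_)
open import Algebra.Bundles using (CommutativeRing)
open import Algebra.Morphism.Structures using (IsRingHomomorphism)

-- Cartan matrix of type A_r (entries in ℚ), indices Fin r  (a ↦ a+1)

C : (r : ℕ) → Fin r → Fin r → ℚ
C r a b with toℕ a ℕ.≟ toℕ b
... | yes _ = 1ℚ ℚ.+ 1ℚ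
... | no _ with toℕ a ℕ.≟ ℕ.suc (toℕ b) | toℕ b ℕ.≟ ℕ.suc (toℕ a)
...   | yes _ | _     = ℚ.- 1ℚ
...   | no _  | yes _ = ℚ.- 1ℚ
...   | no _  | no _  = 0ℚ

δ : (r : ℕ) → Fin r → Fin r → ℚ
δ r a b with toℕ a ℕ.≟ toℕ b
... | yes _ = 1ℚ
... | no _  = 0ℚ

Σℚ : (n : ℕ) → (Fin n → ℚ) → ℚ
Σℚ zero    f = 0ℚ
Σℚ (ℕ.suc n) f = f Data.Fin.zero ℚ.+ Σℚ n (λ k → f (Data.Fin.suc k))

IsInverseOfC : (r : ℕ) → (Fin r → Fin r → ℚ) → Set
IsInverseOfC r M =
  (∀ a b → Σℚ r (λ c → C r a c ℚ.* M c b) ≡ δ r a b) Data.Product.×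
  (∀ a b → Σℚ r (λ c → M a c ℚ.* C r c b) ≡ δ r a b)
  where import Data.Product

-- Ω = [[0, C^{-1}], [-C^{-1}, 0]] in r×r blocks, indices Fin (r ℕ.+ r)
-- (index i ↑ˡ r is A_{i+1} = q_{i+1};  r ↑ʳ i is A_{r+i+1} = p_{i+1})
Ω : (r : ℕ) → (Fin r → Fin r → ℚ) → Fin (r ℕ.+ r) → Fin (r ℕ.+ r) → ℚ
Ω r Cinv i j with splitAt r i | splitAt r j
... | inj₁ a | inj₂ b = Cinv a b
... | inj₂ a | inj₁ b = ℚ.- Cinv a b
... | inj₁ _ | inj₁ _ = 0ℚ
... | inj₂ _ | inj₂ _ = 0ℚ

-- A commutative ℚ-algebra R containing invertible elements A_1..A_{2r},
-- equipped with a bilinear, antisymmetric bracket satisfying Leibniz in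
-- both arguments and {A_i, A_j} = Ω_ij A_i A_j.  (The Laurent polynomial
-- algebra ℚ[A_1^{±1},…,A_{2r}^{±1}] with the paper's bracket is an instance.)

record LogCanonical {c ℓ : Level} (r : ℕ) (Cinv : Fin r → Fin r → ℚ)
                    (R : CommutativeRing c ℓ) : Set (c ⊔ ℓ) where
  open CommutativeRing R
  field
    ι        : ℚ → Carrier
    ι-hom    : IsRingHomomorphism ℚ.+-*-rawRing rawRing ι
    ⟦_,_⟧    : Carrier → Carrier → Carrier
    cong-br  : ∀ {x x' y y'} → x ≈ x' → y ≈ y' → ⟦ x , y ⟧ ≈ ⟦ x' , y' ⟧
    +-linˡ   : ∀ x y z → ⟦ x + y , z ⟧ ≈ ⟦ x , z ⟧ + ⟦ y , z ⟧
    +-linʳ   : ∀ x y z → ⟦ x , y + z ⟧ ≈ ⟦ x , y ⟧ + ⟦ x , z ⟧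
    ℚ-linˡ   : ∀ (t : ℚ) x y → ⟦ ι t * x , y ⟧ ≈ ι t * ⟦ x , y ⟧
    ℚ-linʳ   : ∀ (t : ℚ) x y → ⟦ x , ι t * y ⟧ ≈ ι t * ⟦ x , y ⟧
    antisym  : ∀ x y → ⟦ x , y ⟧ ≈ - ⟦ y , x ⟧
    leibnizˡ : ∀ x y z → ⟦ x * y , z ⟧ ≈ x * ⟦ y , z ⟧ + ⟦ x , z ⟧ * y
    leibnizʳ : ∀ x y z → ⟦ x , y * z ⟧ ≈ ⟦ x , y ⟧ * z + y * ⟦ x , z ⟧
    A        : Fin (r ℕ.+ r) → Carrier
    A⁻¹      : Fin (r ℕ.+ r) → Carrier
    A-inv    : ∀ i → A i * A⁻¹ i ≈ 1#
    A-bracket : ∀ i j → ⟦ A i , A j ⟧ ≈ ι (Ω r Cinv i j) * (A i * A j)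

  -- q_a, p_a for a ∈ ℕ, with q_0 = q_{r+1} = p_0 = p_{r+1} = 1
  -- (values for a > r+1 are never used), and their inverses
  q p q⁻¹ p⁻¹ : ℕ → Carrier
  q zero = 1#
  q (ℕ.suc a) with a ℕ.<? r
  ... | yes a<r = A (fromℕ< a<r ↑ˡ r)
  ... | no _    = 1#
  p zero = 1#
  p (ℕ.suc a) with a ℕ.<? r
  ... | yes a<r = A (r ↑ʳ fromℕ< a<r)
  ... | no _    = 1#
  q⁻¹ zero = 1#
  q⁻¹ (ℕ.suc a) with a ℕ.<? r
  ... | yes a<r = A⁻¹ (fromℕ< a<r ↑ˡ r)
  ... | no _    = 1#
  p⁻¹ zero = 1#
  p⁻¹ (ℕ.suc a) with a ℕ.<? r
  ... | yes a<r = A⁻¹ (r ↑ʳ fromℕ< a<r)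
  ... | no _    = 1#

  γodd γeven : ℕ → Carrier
  γodd  a = (q (a ℕ.∸ 1) * p a) * (q⁻¹ a * p⁻¹ (a ℕ.∸ 1))
  γeven a = (q (a ℕ.∸ 1) * p (ℕ.suc a)) * (q⁻¹ a * p⁻¹ a)

  isEven : ℕ → Bool
  isEven zero = true
  isEven (ℕ.suc zero) = false
  isEven (ℕ.suc (ℕ.suc n)) = isEven n

  -- γ_i for i ≥ 1 (γ_0 is a dummy value, never used)
  γ : ℕ → Carrier
  γ zero = 1#
  γ (ℕ.suc k) = if isEven k then γodd (ℕ.suc ℕ.⌊ k /2⌋) else γeven (ℕ.suc ℕ.⌊ k /2⌋)

data Edge (r : ℕ) : ℕ → ℕ → Set where
  path : ∀ {i} → 1 ℕ.≤ i → i ℕ.≤ 2 ℕ.* r → Edge r i (ℕ.suc i)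
  skip : ∀ {a} → 1 ℕ.≤ a → a ℕ.+ 1 ℕ.≤ r → Edge r (2 ℕ.* a) (2 ℕ.* a ℕ.+ 2)

Adj : (r : ℕ) → ℕ → ℕ → Set
Adj r i j = Edge r i j ⊎ Edge r j i

-- Write Q_a = q_{a-1}/q_a and P_a = p_{a-1}/p_a. Then γ_{2a-1} = Q_a/P_a and γ_{2a} = Q_a/P_{a+1},
-- so every γ_i is Q_a/P_b with (a, b) = (⌈i/2⌉, ⌊i/2⌋ + 1). Monomials in the A_i are log-canonical,
-- with coefficient bilinear in the exponent vectors; hence {γ_i, γ_j} = (K_{b,c} - K_{a,d}) γ_i γ_j
-- for γ_j = Q_c/P_d, where K is the mixed second difference of the zero-padded matrix C^{-1}.
-- Multiplying C^{-1} by the tridiagonal C from either side shows that K - I is constant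
-- (it is -1/(r+1)), so the coefficient is δ_{bc} - δ_{ad}, and a parity check on i, j identifies
-- this with ε_ij.

module Submission where

open import Defs
open import Level using (Level)
open import Data.Nat as ℕ using (ℕ; zero; suc; _≤_; _<_; z≤n; s≤s; _≡ᵇ_; ⌊_/2⌋; ⌈_/2⌉; pred)
import Data.Nat.Properties as ℕP
open import Data.Fin as Fin using (Fin; toℕ; fromℕ<; _↑ˡ_; _↑ʳ_)
import Data.Fin.Properties as FinP
open import Data.Bool using (true; false; if_then_else_)
open import Data.Maybe using (Maybe; just; nothing; maybe)
open import Relation.Nullary.Decidable.Core using (dec⇒maybe)
open import Data.Sum using (_⊎_; inj₁; inj₂)
open import Data.Product using (_×_; _,_; proj₁; proj₂)
open import Data.Rational as ℚ using (ℚ; 0ℚ; 1ℚ)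
import Data.Rational.Properties as ℚP
open import Relation.Nullary using (yes; no; ¬_; contradiction)
open import Relation.Binary.PropositionalEquality
  using (_≡_; _≢_; refl; sym; trans; cong; cong₂; subst; subst₂; module ≡-Reasoning)
open import Function using (_∘_)
open import Algebra.Bundles using (CommutativeRing)
open import Algebra.Morphism.Structures using (IsRingHomomorphism)
import Tactic.RingSolver.Core.AlmostCommutativeRing as ACR
open import Tactic.RingSolver using (solve-∀)
open import Relation.Binary.Definitions using (WeaklyDecidable)
open import Algebra.Solver.Ring.AlmostCommutativeRing
  using (fromCommutativeRing; _-Raw-AlmostCommutative⟶_; Induced-equivalence)
import Algebra.Solver.Ring

ℚ-ring : ACR.AlmostCommutativeRing _ _
ℚ-ring = ACR.fromCommutativeRing ℚP.+-*-commutativeRing (dec⇒maybe ∘ (0ℚ ℚ.≟_))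

δℕ : ℕ → ℕ → ℚ
δℕ m n = if m ≡ᵇ n then 1ℚ else 0ℚ

δℕ-refl : ∀ n → δℕ n n ≡ 1ℚ
δℕ-refl zero    = refl
δℕ-refl (suc n) = δℕ-refl n

δℕ-≢ : ∀ m n → m ≢ n → δℕ m n ≡ 0ℚ
δℕ-≢ zero    zero    m≢n = contradiction refl m≢n
δℕ-≢ zero    (suc n) _   = refl
δℕ-≢ (suc m) zero    _   = refl
δℕ-≢ (suc m) (suc n) m≢n = δℕ-≢ m n (m≢n ∘ cong suc)

δℕ-sym : ∀ m n → δℕ m n ≡ δℕ n m
δℕ-sym zero    zero    = refl
δℕ-sym zero    (suc n) = refl
δℕ-sym (suc m) zero    = refl
δℕ-sym (suc m) (suc n) = δℕ-sym m n

cartanℕ : ℕ → ℕ → ℚ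
cartanℕ k m = (δℕ k m ℚ.+ δℕ k m) ℚ.- (δℕ k (suc m) ℚ.+ δℕ (suc k) m)

cartanℕ-diag : ∀ n → cartanℕ n n ≡ 1ℚ ℚ.+ 1ℚ
cartanℕ-diag zero    = refl
cartanℕ-diag (suc n) = cartanℕ-diag n

cartanℕ-sub : ∀ n → cartanℕ (suc n) n ≡ ℚ.- 1ℚ
cartanℕ-sub zero    = refl
cartanℕ-sub (suc n) = cartanℕ-sub n

cartanℕ-super : ∀ n → cartanℕ n (suc n) ≡ ℚ.- 1ℚ
cartanℕ-super zero    = refl
cartanℕ-super (suc n) = cartanℕ-super n

cartanℕ-far : ∀ {k m} → k ≢ m → k ≢ suc m → m ≢ suc k → cartanℕ k m ≡ 0ℚ
cartanℕ-far {zero}        {zero}        k≢m _ _ = contradiction refl k≢m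
cartanℕ-far {zero}        {suc zero}    _ _ m≢k+1 = contradiction refl m≢k+1
cartanℕ-far {zero}        {suc (suc m)} _ _ _ = refl
cartanℕ-far {suc zero}    {zero}        _ k≢m+1 _ = contradiction refl k≢m+1
cartanℕ-far {suc (suc k)} {zero}        _ _ _ = refl
cartanℕ-far {suc k}       {suc m}       k≢m k≢m+1 m≢k+1 =
  cartanℕ-far (k≢m ∘ cong suc) (k≢m+1 ∘ cong suc) (m≢k+1 ∘ cong suc)

cartanℕ-sym : ∀ k m → cartanℕ k m ≡ cartanℕ m k
cartanℕ-sym zero          zero          = refl
cartanℕ-sym zero          (suc zero)    = refl
cartanℕ-sym zero          (suc (suc m)) = refl
cartanℕ-sym (suc zero)    zero          = refl
cartanℕ-sym (suc (suc k)) zero          = refl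
cartanℕ-sym (suc k)       (suc m)       = cartanℕ-sym k m

C≡cartanℕ : ∀ {r} (a b : Fin r) → C r a b ≡ cartanℕ (toℕ a) (toℕ b)
C≡cartanℕ a b with toℕ a ℕ.≟ toℕ b
... | yes a≡b rewrite a≡b = sym (cartanℕ-diag (toℕ b))
... | no a≢b with toℕ a ℕ.≟ suc (toℕ b) | toℕ b ℕ.≟ suc (toℕ a)
...   | yes a≡b+1 | _         rewrite a≡b+1 = sym (cartanℕ-sub (toℕ b))
...   | no _      | yes b≡a+1 rewrite b≡a+1 = sym (cartanℕ-super (toℕ a))
...   | no a≢b+1  | no b≢a+1  = sym (cartanℕ-far a≢b a≢b+1 b≢a+1)

δ≡δℕ : ∀ {r} (a b : Fin r) → δ r a b ≡ δℕ (toℕ a) (toℕ b)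
δ≡δℕ a b with toℕ a ℕ.≟ toℕ b
... | yes a≡b rewrite a≡b = sym (δℕ-refl (toℕ b))
... | no a≢b  = sym (δℕ-≢ (toℕ a) (toℕ b) a≢b)

Σℚ-cong : ∀ n {f g : Fin n → ℚ} → (∀ c → f c ≡ g c) → Σℚ n f ≡ Σℚ n g
Σℚ-cong zero    f≗g = refl
Σℚ-cong (suc n) f≗g = cong₂ ℚ._+_ (f≗g Fin.zero) (Σℚ-cong n (f≗g ∘ Fin.suc))

Σℚ-*0 : ∀ n (f : Fin n → ℚ) → Σℚ n (λ c → f c ℚ.* 0ℚ) ≡ 0ℚ
Σℚ-*0 zero    f = refl
Σℚ-*0 (suc n) f = cong₂ ℚ._+_ (ℚP.*-zeroʳ (f Fin.zero)) (Σℚ-*0 n (f ∘ Fin.suc))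

-- Δ² g n is the row g multiplied by the Cartan matrix, evaluated at column n + 1.
Δ² : (ℕ → ℚ) → ℕ → ℚ
Δ² g n = (g (suc n) ℚ.+ g (suc n)) ℚ.- (g n ℚ.+ g (suc (suc n)))

Δ²-cong : ∀ {g h : ℕ → ℚ} → (∀ k → g k ≡ h k) → ∀ n → Δ² g n ≡ Δ² h n
Δ²-cong g≗h n =
  cong₂ ℚ._-_ (cong₂ ℚ._+_ (g≗h (suc n)) (g≗h (suc n))) (cong₂ ℚ._+_ (g≗h n) (g≗h (suc (suc n))))

0∷ : (ℕ → ℚ) → ℕ → ℚ
0∷ f zero    = 0ℚ
0∷ f (suc n) = f n

-- Only the rows m - 1, m, m + 1 of column m of the Cartan matrix are nonzero;
-- 0∷ and the hypothesis f n ≡ 0 supply the values just outside [0, n).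
Σ-cartanℕ : ∀ n (f : ℕ → ℚ) m → m < n → f n ≡ 0ℚ →
            Σℚ n (λ c → f (toℕ c) ℚ.* cartanℕ (toℕ c) m) ≡ Δ² (0∷ f) m
Σ-cartanℕ (suc zero) f zero _ f₁≡0 rewrite f₁≡0 = one-by-one (f 0)
  where
  one-by-one : ∀ x → x ℚ.* (1ℚ ℚ.+ 1ℚ) ℚ.+ 0ℚ ≡ (x ℚ.+ x) ℚ.- (0ℚ ℚ.+ 0ℚ)
  one-by-one = solve-∀ ℚ-ring
Σ-cartanℕ (suc (suc n)) f zero _ _ rewrite Σℚ-*0 n (λ c → f (suc (suc (toℕ c)))) = column₀ (f 0) (f 1)
  where
  column₀ : ∀ x y → x ℚ.* (1ℚ ℚ.+ 1ℚ) ℚ.+ (y ℚ.* ℚ.- 1ℚ ℚ.+ 0ℚ) ≡ (x ℚ.+ x) ℚ.- (0ℚ ℚ.+ y)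
  column₀ = solve-∀ ℚ-ring
Σ-cartanℕ (suc n) f (suc zero) (s≤s 0<n) fₙ≡0
  rewrite Σ-cartanℕ n (f ∘ suc) zero 0<n fₙ≡0 = column₁ (f 0) (f 1) (f 2)
  where
  column₁ : ∀ x y z → x ℚ.* ℚ.- 1ℚ ℚ.+ ((y ℚ.+ y) ℚ.- (0ℚ ℚ.+ z)) ≡ (y ℚ.+ y) ℚ.- (x ℚ.+ z)
  column₁ = solve-∀ ℚ-ring
Σ-cartanℕ (suc n) f (suc (suc m)) (s≤s m+1<n) fₙ≡0
  rewrite Σ-cartanℕ n (f ∘ suc) (suc m) m+1<n fₙ≡0 = column₂₊ (f 0) _
  where
  column₂₊ : ∀ x y → x ℚ.* 0ℚ ℚ.+ y ≡ y
  column₂₊ = solve-∀ ℚ-ring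

C-sym : ∀ {r} (a b : Fin r) → C r a b ≡ C r b a
C-sym a b = trans (C≡cartanℕ a b) (trans (cartanℕ-sym (toℕ a) (toℕ b)) (sym (C≡cartanℕ b a)))

δ-sym : ∀ {r} (a b : Fin r) → δ r a b ≡ δ r b a
δ-sym a b = trans (δ≡δℕ a b) (trans (δℕ-sym (toℕ a) (toℕ b)) (sym (δ≡δℕ b a)))

IsRightInverseOfC : (r : ℕ) → (Fin r → Fin r → ℚ) → Set
IsRightInverseOfC r N = ∀ a b → Σℚ r (λ c → N a c ℚ.* C r c b) ≡ δ r a b

transpose-rightInverse : ∀ {r} (N : Fin r → Fin r → ℚ) →
                         (∀ a b → Σℚ r (λ c → C r a c ℚ.* N c b) ≡ δ r a b) →
                         IsRightInverseOfC r (λ i j → N j i)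
transpose-rightInverse {r} N CN≡I a b = begin
  Σℚ r (λ c → N c a ℚ.* C r c b)  ≡⟨ Σℚ-cong r swap ⟩
  Σℚ r (λ c → C r b c ℚ.* N c a)  ≡⟨ CN≡I b a ⟩
  δ r b a                          ≡⟨ δ-sym b a ⟩
  δ r a b                          ∎
  where
  open ≡-Reasoning
  swap : ∀ c → N c a ℚ.* C r c b ≡ C r b c ℚ.* N c a
  swap c = trans (ℚP.*-comm (N c a) (C r c b)) (cong (ℚ._* N c a) (C-sym c b))

module Padding (r : ℕ) where

  -- The paper's index x ∈ [1, r] is slot x = just (x - 1); all other x are padding.
  slot : ℕ → Maybe (Fin r)
  slot zero = nothing
  slot (suc a) with a ℕ.<? r
  ... | yes a<r = just (fromℕ< a<r)
  ... | no _    = nothing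

  slot-toℕ : ∀ (i : Fin r) → slot (suc (toℕ i)) ≡ just i
  slot-toℕ i with toℕ i ℕ.<? r
  ... | yes i<r = cong just (FinP.fromℕ<-toℕ i i<r)
  ... | no i≮r  = contradiction (FinP.toℕ<n i) i≮r

  slot-≥ : ∀ {a} → r ≤ a → slot (suc a) ≡ nothing
  slot-≥ {a} r≤a with a ℕ.<? r
  ... | yes a<r = contradiction a<r (ℕP.≤⇒≯ r≤a)
  ... | no _    = refl

  lift : (Fin r → Fin r → ℚ) → Maybe (Fin r) → Maybe (Fin r) → ℚ
  lift f (just i) (just j) = f i j
  lift f _        _        = 0ℚ

  pad : (Fin r → Fin r → ℚ) → ℕ → ℕ → ℚ
  pad f x y = lift f (slot x) (slot y)

  pad-toℕ : ∀ f (i j : Fin r) → pad f (suc (toℕ i)) (suc (toℕ j)) ≡ f i j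
  pad-toℕ f i j rewrite slot-toℕ i | slot-toℕ j = refl

  pad-col₀ : ∀ f x → pad f x 0 ≡ 0ℚ
  pad-col₀ f x with slot x
  ... | just _  = refl
  ... | nothing = refl

  pad-col≥ : ∀ f x {b} → r ≤ b → pad f x (suc b) ≡ 0ℚ
  pad-col≥ f x r≤b rewrite slot-≥ r≤b = pad-col₀ f x

  pad-row≥ : ∀ f {a} → r ≤ a → ∀ y → pad f (suc a) y ≡ 0ℚ
  pad-row≥ f r≤a y rewrite slot-≥ r≤a = refl

  pad-transpose : ∀ f x y → pad (λ i j → f j i) y x ≡ pad f x y
  pad-transpose f x y with slot x | slot y
  ... | just _  | just _  = refl
  ... | just _  | nothing = refl
  ... | nothing | just _  = refl
  ... | nothing | nothing = refl

  pad-neg : ∀ f x y → pad (λ i j → ℚ.- f i j) x y ≡ ℚ.- pad f x y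
  pad-neg f x y with slot x | slot y
  ... | just _  | just _  = refl
  ... | just _  | nothing = refl
  ... | nothing | _       = refl

  pad-0 : ∀ x y → pad (λ _ _ → 0ℚ) x y ≡ 0ℚ
  pad-0 x y with slot x | slot y
  ... | just _  | just _  = refl
  ... | just _  | nothing = refl
  ... | nothing | _       = refl

  -- N · C = I, restated for the padded matrix and all rows x.
  rightInverse-Δ² : ∀ (N : Fin r → Fin r → ℚ) → IsRightInverseOfC r N →
                    ∀ x n → n < r → Δ² (pad N x) n ≡ δℕ x (suc n)
  rightInverse-Δ² N NC≡I zero n n<r = refl
  rightInverse-Δ² N NC≡I (suc a) n n<r with ℕP.<-≤-connex a r
  ... | inj₂ r≤a = trans (Δ²-cong (pad-row≥ N r≤a) n)
                         (sym (δℕ-≢ a n λ { refl → ℕP.<⇒≱ n<r r≤a }))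
  ... | inj₁ a<r = begin
    Δ² (pad N (suc a)) n          ≡⟨ Δ²-cong (λ y → sym (padded-row y)) n ⟩
    Δ² (0∷ (pad N (suc a) ∘ suc)) n
      ≡⟨ sym (Σ-cartanℕ r (pad N (suc a) ∘ suc) n n<r (pad-col≥ N (suc a) ℕP.≤-refl)) ⟩
    Σℚ r (λ c → pad N (suc a) (suc (toℕ c)) ℚ.* cartanℕ (toℕ c) n)
      ≡⟨ Σℚ-cong r entry ⟩
    Σℚ r (λ c → N A c ℚ.* C r c B)  ≡⟨ NC≡I A B ⟩
    δ r A B                        ≡⟨ δ≡δℕ A B ⟩
    δℕ (toℕ A) (toℕ B)             ≡⟨ cong₂ δℕ (FinP.toℕ-fromℕ< a<r) (FinP.toℕ-fromℕ< n<r) ⟩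
    δℕ a n                         ∎
    where
    open ≡-Reasoning
    A B : Fin r
    A = fromℕ< a<r
    B = fromℕ< n<r
    padded-row : ∀ y → 0∷ (pad N (suc a) ∘ suc) y ≡ pad N (suc a) y
    padded-row zero    = sym (pad-col₀ N (suc a))
    padded-row (suc y) = refl
    N-entry : ∀ c → pad N (suc a) (suc (toℕ c)) ≡ N A c
    N-entry c =
      trans (cong (λ a′ → pad N (suc a′) (suc (toℕ c))) (sym (FinP.toℕ-fromℕ< a<r))) (pad-toℕ N A c)
    C-entry : ∀ c → cartanℕ (toℕ c) n ≡ C r c B
    C-entry c = trans (cong (cartanℕ (toℕ c)) (sym (FinP.toℕ-fromℕ< n<r))) (sym (C≡cartanℕ c B))
    entry : ∀ c → pad N (suc a) (suc (toℕ c)) ℚ.* cartanℕ (toℕ c) n ≡ N A c ℚ.* C r c B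
    entry c = cong₂ ℚ._*_ (N-entry c) (C-entry c)

mixedDiff : (ℕ → ℕ → ℚ) → ℕ → ℕ → ℚ
mixedDiff f m n = (f m n ℚ.- f m (suc n)) ℚ.- (f (suc m) n ℚ.- f (suc m) (suc n))

mixedDiff-cong : ∀ {f g : ℕ → ℕ → ℚ} → (∀ x y → f x y ≡ g x y) →
                 ∀ m n → mixedDiff f m n ≡ mixedDiff g m n
mixedDiff-cong f≗g m n =
  cong₂ ℚ._-_ (cong₂ ℚ._-_ (f≗g m n) (f≗g m (suc n))) (cong₂ ℚ._-_ (f≗g (suc m) n) (f≗g (suc m) (suc n)))

mixedDiff-neg : ∀ f m n → mixedDiff (λ x y → ℚ.- f x y) m n ≡ ℚ.- mixedDiff f m n
mixedDiff-neg f m n = identity (f m n) (f m (suc n)) (f (suc m) n) (f (suc m) (suc n))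
  where
  identity : ∀ a b c d → (ℚ.- a ℚ.- ℚ.- b) ℚ.- (ℚ.- c ℚ.- ℚ.- d) ≡ ℚ.- ((a ℚ.- b) ℚ.- (c ℚ.- d))
  identity = solve-∀ ℚ-ring

mixedDiff-sucʳ : ∀ f m n →
  mixedDiff f m (suc n) ≡ mixedDiff f m n ℚ.+ (Δ² (f m) n ℚ.- Δ² (f (suc m)) n)
mixedDiff-sucʳ f m n = identity (f m n) (f m (suc n)) (f m (suc (suc n)))
                                (f (suc m) n) (f (suc m) (suc n)) (f (suc m) (suc (suc n)))
  where
  identity : ∀ a b c d e g → (b ℚ.- c) ℚ.- (e ℚ.- g) ≡
             ((a ℚ.- b) ℚ.- (d ℚ.- e)) ℚ.+ (((b ℚ.+ b) ℚ.- (a ℚ.+ c)) ℚ.- ((e ℚ.+ e) ℚ.- (d ℚ.+ g)))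
  identity = solve-∀ ℚ-ring

mixedDiff-sucˡ : ∀ f m n →
  mixedDiff f (suc m) n ≡ mixedDiff f m n ℚ.+ (Δ² (λ x → f x n) m ℚ.- Δ² (λ x → f x (suc n)) m)
mixedDiff-sucˡ f m n = identity (f m n) (f (suc m) n) (f (suc (suc m)) n)
                                (f m (suc n)) (f (suc m) (suc n)) (f (suc (suc m)) (suc n))
  where
  identity : ∀ a b c d e g → (b ℚ.- e) ℚ.- (c ℚ.- g) ≡
             ((a ℚ.- d) ℚ.- (b ℚ.- e)) ℚ.+ (((b ℚ.+ b) ℚ.- (a ℚ.+ c)) ℚ.- ((e ℚ.+ e) ℚ.- (d ℚ.+ g)))
  identity = solve-∀ ℚ-ring

module CartanInverse {r} (Cinv : Fin r → Fin r → ℚ) (inv : IsInverseOfC r Cinv) where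
  open Padding r

  M : ℕ → ℕ → ℚ
  M = pad Cinv

  M-rows : ∀ x n → n < r → Δ² (M x) n ≡ δℕ x (suc n)
  M-rows = rightInverse-Δ² Cinv (proj₂ inv)

  M-cols : ∀ y n → n < r → Δ² (λ x → M x y) n ≡ δℕ (suc n) y
  M-cols y n n<r = begin
    Δ² (λ x → M x y) n                   ≡⟨ Δ²-cong (λ x → sym (pad-transpose Cinv x y)) n ⟩
    Δ² (pad (λ i j → Cinv j i) y) n
      ≡⟨ rightInverse-Δ² _ (transpose-rightInverse Cinv (proj₁ inv)) y n n<r ⟩
    δℕ y (suc n)                         ≡⟨ δℕ-sym y (suc n) ⟩
    δℕ (suc n) y                         ∎
    where open ≡-Reasoning

  -- In fact mixedDiff M m n = δ m n - 1/(r+1) on [0, r]²; only the constancy is needed.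
  offDiagonal : ℕ → ℕ → ℚ
  offDiagonal m n = mixedDiff M m n ℚ.- δℕ m n

  private
    cancel : ∀ k u v → (k ℚ.+ (u ℚ.- v)) ℚ.- u ≡ k ℚ.- v
    cancel = solve-∀ ℚ-ring

  offDiagonal-sucʳ : ∀ m n → n < r → offDiagonal m (suc n) ≡ offDiagonal m n
  offDiagonal-sucʳ m n n<r = begin
    mixedDiff M m (suc n) ℚ.- δℕ m (suc n)
      ≡⟨ cong (ℚ._- δℕ m (suc n)) (mixedDiff-sucʳ M m n) ⟩
    (mixedDiff M m n ℚ.+ (Δ² (M m) n ℚ.- Δ² (M (suc m)) n)) ℚ.- δℕ m (suc n)
      ≡⟨ cong (λ t → (mixedDiff M m n ℚ.+ t) ℚ.- δℕ m (suc n))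
              (cong₂ ℚ._-_ (M-rows m n n<r) (M-rows (suc m) n n<r)) ⟩
    (mixedDiff M m n ℚ.+ (δℕ m (suc n) ℚ.- δℕ m n)) ℚ.- δℕ m (suc n)
      ≡⟨ cancel (mixedDiff M m n) (δℕ m (suc n)) (δℕ m n) ⟩
    mixedDiff M m n ℚ.- δℕ m n ∎
    where open ≡-Reasoning

  offDiagonal-sucˡ : ∀ m n → m < r → offDiagonal (suc m) n ≡ offDiagonal m n
  offDiagonal-sucˡ m n m<r = begin
    mixedDiff M (suc m) n ℚ.- δℕ (suc m) n
      ≡⟨ cong (ℚ._- δℕ (suc m) n) (mixedDiff-sucˡ M m n) ⟩
    (mixedDiff M m n ℚ.+ (Δ² (λ x → M x n) m ℚ.- Δ² (λ x → M x (suc n)) m)) ℚ.- δℕ (suc m) n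
      ≡⟨ cong (λ t → (mixedDiff M m n ℚ.+ t) ℚ.- δℕ (suc m) n)
              (cong₂ ℚ._-_ (M-cols n m m<r) (M-cols (suc n) m m<r)) ⟩
    (mixedDiff M m n ℚ.+ (δℕ (suc m) n ℚ.- δℕ m n)) ℚ.- δℕ (suc m) n
      ≡⟨ cancel (mixedDiff M m n) (δℕ (suc m) n) (δℕ m n) ⟩
    mixedDiff M m n ℚ.- δℕ m n ∎
    where open ≡-Reasoning

  offDiagonal-constant : ∀ m n → m ≤ r → n ≤ r → offDiagonal m n ≡ offDiagonal 0 0
  offDiagonal-constant zero    zero    _    _    = refl
  offDiagonal-constant zero    (suc n) _    n<r  =
    trans (offDiagonal-sucʳ 0 n n<r) (offDiagonal-constant 0 n z≤n (ℕP.<⇒≤ n<r))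
  offDiagonal-constant (suc m) n       m<r  n≤r  =
    trans (offDiagonal-sucˡ m n m<r) (offDiagonal-constant m n (ℕP.<⇒≤ m<r) n≤r)

  mixedDiff-M-δ : ∀ {a b c d} → a ≤ r → b ≤ r → c ≤ r → d ≤ r →
                mixedDiff M b c ℚ.- mixedDiff M a d ≡ δℕ b c ℚ.- δℕ a d
  mixedDiff-M-δ {a} {b} {c} {d} a≤r b≤r c≤r d≤r = begin
    X ℚ.- Y                                  ≡⟨ regroup X Y u v ⟩
    (u ℚ.- v) ℚ.+ ((X ℚ.- u) ℚ.- (Y ℚ.- v))  ≡⟨ cong (λ t → (u ℚ.- v) ℚ.+ (t ℚ.- (Y ℚ.- v))) same ⟩
    (u ℚ.- v) ℚ.+ ((Y ℚ.- v) ℚ.- (Y ℚ.- v))  ≡⟨ cong ((u ℚ.- v) ℚ.+_) (ℚP.+-inverseʳ (Y ℚ.- v)) ⟩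
    (u ℚ.- v) ℚ.+ 0ℚ                         ≡⟨ ℚP.+-identityʳ (u ℚ.- v) ⟩
    u ℚ.- v                                  ∎
    where
    open ≡-Reasoning
    X Y u v : ℚ
    X = mixedDiff M b c
    Y = mixedDiff M a d
    u = δℕ b c
    v = δℕ a d
    same : X ℚ.- u ≡ Y ℚ.- v
    same = trans (offDiagonal-constant b c b≤r c≤r) (sym (offDiagonal-constant a d a≤r d≤r))
    regroup : ∀ x y u v → x ℚ.- y ≡ (u ℚ.- v) ℚ.+ ((x ℚ.- u) ℚ.- (y ℚ.- v))
    regroup = solve-∀ ℚ-ring

⌊2*n/2⌋ : ∀ n → ⌊ 2 ℕ.* n /2⌋ ≡ n
⌊2*n/2⌋ zero    = refl
⌊2*n/2⌋ (suc n) = trans (cong ⌊_/2⌋ (ℕP.*-suc 2 n)) (cong suc (⌊2*n/2⌋ n))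

⌊1+2*n/2⌋ : ∀ n → ⌊ suc (2 ℕ.* n) /2⌋ ≡ n
⌊1+2*n/2⌋ zero    = refl
⌊1+2*n/2⌋ (suc n) = trans (cong (⌊_/2⌋ ∘ suc) (ℕP.*-suc 2 n)) (cong suc (⌊1+2*n/2⌋ n))

⌊n/2⌋≡a⇒parity : ∀ n {a} → ⌊ n /2⌋ ≡ a → n ≡ 2 ℕ.* a ⊎ n ≡ suc (2 ℕ.* a)
⌊n/2⌋≡a⇒parity zero          refl = inj₁ refl
⌊n/2⌋≡a⇒parity (suc zero)    refl = inj₂ refl
⌊n/2⌋≡a⇒parity (suc (suc n)) refl with ⌊n/2⌋≡a⇒parity n refl
... | inj₁ n≡2a  = inj₁ (trans (cong (suc ∘ suc) n≡2a) (sym (ℕP.*-suc 2 ⌊ n /2⌋)))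
... | inj₂ n≡2a+1 = inj₂ (trans (cong (suc ∘ suc) n≡2a+1) (cong suc (sym (ℕP.*-suc 2 ⌊ n /2⌋))))

2*n+1≡1+2*n : ∀ n → 2 ℕ.* n ℕ.+ 1 ≡ suc (2 ℕ.* n)
2*n+1≡1+2*n n = ℕP.+-comm (2 ℕ.* n) 1

⌊/2⌋-≤ : ∀ {r n} → n ≤ 2 ℕ.* r ℕ.+ 1 → ⌊ n /2⌋ ≤ r
⌊/2⌋-≤ {r} n≤ = ℕP.≤-trans (ℕP.⌊n/2⌋-mono n≤)
  (ℕP.≤-reflexive (trans (cong ⌊_/2⌋ (2*n+1≡1+2*n r)) (⌊1+2*n/2⌋ r)))

edge-< : ∀ {r i j} → Edge r i j → i < j
edge-< (path _ _)       = ℕP.n<1+n _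
edge-< (skip {a} _ _)   = ℕP.m<m+n (2 ℕ.* a) (s≤s z≤n)

edge-positive : ∀ {r i j} → Edge r i j → 1 ≤ i
edge-positive (path 1≤i _)             = 1≤i
edge-positive (skip {suc a} _ _)       = s≤s z≤n

edge-⌊/2⌋ : ∀ {r i j} → Edge r i j → ⌊ i /2⌋ ≡ ⌊ pred j /2⌋
edge-⌊/2⌋ (path _ _)     = refl
edge-⌊/2⌋ (skip {a} _ _) = trans (⌊2*n/2⌋ a)
  (sym (trans (cong (⌊_/2⌋ ∘ pred) (ℕP.+-comm (2 ℕ.* a) 2)) (⌊1+2*n/2⌋ a)))

⌊pred/2⌋-< : ∀ {i j} → 1 ≤ i → i < j → ⌊ pred i /2⌋ < ⌊ j /2⌋
⌊pred/2⌋-< {suc i} _ i<j = ℕP.<-≤-trans (ℕP.n<1+n ⌊ i /2⌋) (ℕP.⌊n/2⌋-mono i<j)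

path-edge : ∀ {r i j} → 1 ≤ i → i ≡ j → suc j ≤ 2 ℕ.* r ℕ.+ 1 → Edge r i (suc j)
path-edge {r} {i} 1≤i refl i<2r+1 = path 1≤i (ℕP.≤-pred (subst (suc i ≤_) (2*n+1≡1+2*n r) i<2r+1))

same-block⇒adjacent : ∀ {r i j} → 1 ≤ i → 1 ≤ j → j ≤ 2 ℕ.* r ℕ.+ 1 →
                      ⌊ i /2⌋ ≡ ⌊ pred j /2⌋ → i ≡ j ⊎ Edge r i j
same-block⇒adjacent {r} {i} {suc j} 1≤i _ j<2r+1 same
  with ⌊n/2⌋≡a⇒parity i refl | ⌊n/2⌋≡a⇒parity j (sym same)
... | inj₂ i≡2a+1 | inj₁ j≡2a   = inj₁ (trans i≡2a+1 (cong suc (sym j≡2a)))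
... | inj₁ i≡2a   | inj₁ j≡2a   = inj₂ (path-edge 1≤i (trans i≡2a (sym j≡2a)) j<2r+1)
... | inj₂ i≡2a+1 | inj₂ j≡2a+1 = inj₂ (path-edge 1≤i (trans i≡2a+1 (sym j≡2a+1)) j<2r+1)
... | inj₁ i≡2a   | inj₂ j≡2a+1 = inj₂ (subst₂ (Edge r) (sym i≡2a) 2a+2≡j+1 (skip 1≤a a+1≤r))
  where
  a : ℕ
  a = ⌊ i /2⌋
  2a+2≡j+1 : 2 ℕ.* a ℕ.+ 2 ≡ suc j
  2a+2≡j+1 = trans (ℕP.+-comm (2 ℕ.* a) 2) (cong suc (sym j≡2a+1))
  1≤a : 1 ≤ a
  1≤a = ℕP.n≢0⇒n>0 (λ a≡0 → ℕP.<⇒≢ 1≤i (sym (trans i≡2a (cong (2 ℕ.*_) a≡0))))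
  a+1≤r : a ℕ.+ 1 ≤ r
  a+1≤r = subst (_≤ r) (trans (cong (⌊_/2⌋ ∘ suc) j≡2a+1) (trans (cong suc (⌊2*n/2⌋ a)) (ℕP.+-comm 1 a)))
                (⌊/2⌋-≤ j<2r+1)

-- The paper's ε_ij in closed form; γ-bracket shows it is the coefficient of ⟦ γ i , γ j ⟧.
ε : ℕ → ℕ → ℚ
ε i j = δℕ ⌊ i /2⌋ ⌊ pred j /2⌋ ℚ.- δℕ ⌊ pred i /2⌋ ⌊ j /2⌋

ε-edge : ∀ {r i j} → Edge r i j → ε i j ≡ 1ℚ
ε-edge {i = i} {j} e =
  cong₂ ℚ._-_ (trans (cong (δℕ ⌊ i /2⌋) (sym (edge-⌊/2⌋ e))) (δℕ-refl ⌊ i /2⌋))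
              (δℕ-≢ ⌊ pred i /2⌋ ⌊ j /2⌋ (ℕP.<⇒≢ (⌊pred/2⌋-< (edge-positive e) (edge-< e))))

ε-nonadjacent : ∀ {r i j} → 1 ≤ i → i ≤ 2 ℕ.* r ℕ.+ 1 → 1 ≤ j → j ≤ 2 ℕ.* r ℕ.+ 1 →
                ¬ Adj r i j → ε i j ≡ 0ℚ
ε-nonadjacent {r} {i} {j} 1≤i i≤ 1≤j j≤ ¬adj with i ℕ.≟ j
... | yes refl = trans (cong (ℚ._- δℕ ⌊ pred i /2⌋ ⌊ i /2⌋) (δℕ-sym ⌊ i /2⌋ ⌊ pred i /2⌋))
                       (ℚP.+-inverseʳ (δℕ ⌊ pred i /2⌋ ⌊ i /2⌋))
... | no i≢j =
  cong₂ ℚ._-_ (δℕ-≢ ⌊ i /2⌋ ⌊ pred j /2⌋ forward) (δℕ-≢ ⌊ pred i /2⌋ ⌊ j /2⌋ backward)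
  where
  forward : ⌊ i /2⌋ ≢ ⌊ pred j /2⌋
  forward same with same-block⇒adjacent 1≤i 1≤j j≤ same
  ... | inj₁ i≡j = i≢j i≡j
  ... | inj₂ e   = ¬adj (inj₁ e)
  backward : ⌊ pred i /2⌋ ≢ ⌊ j /2⌋
  backward same with same-block⇒adjacent 1≤j 1≤i i≤ (sym same)
  ... | inj₁ j≡i = i≢j (sym j≡i)
  ... | inj₂ e   = ¬adj (inj₂ e)

data Kind : Set where
  Q P : Kind

module Coefficients {r : ℕ} (Cinv : Fin r → Fin r → ℚ) where
  open Padding r

  place : Kind → Fin r → Fin (r ℕ.+ r)
  place Q i = i ↑ˡ r
  place P i = r ↑ʳ i

  block : Kind → Kind → Fin r → Fin r → ℚ
  block Q P i j = Cinv i j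
  block P Q i j = ℚ.- Cinv i j
  block Q Q _ _ = 0ℚ
  block P P _ _ = 0ℚ

  Ω-block : ∀ k k′ i j → Ω r Cinv (place k i) (place k′ j) ≡ block k k′ i j
  Ω-block Q Q i j rewrite FinP.splitAt-↑ˡ r i r | FinP.splitAt-↑ˡ r j r = refl
  Ω-block Q P i j rewrite FinP.splitAt-↑ˡ r i r | FinP.splitAt-↑ʳ r r j = refl
  Ω-block P Q i j rewrite FinP.splitAt-↑ʳ r r i | FinP.splitAt-↑ˡ r j r = refl
  Ω-block P P i j rewrite FinP.splitAt-↑ʳ r r i | FinP.splitAt-↑ʳ r r j = refl

  ω : Kind → Kind → ℕ → ℕ → ℚ
  ω k k′ = pad (block k k′)

  -- The coefficient of ⟦ ratio Q a * ratio⁻¹ P b , ratio Q c * ratio⁻¹ P d ⟧ in the shape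
  -- in which the Leibniz rule produces it.
  ratio-coefficient : ∀ a b c d →
    (mixedDiff (ω Q Q) a c ℚ.+ ℚ.- mixedDiff (ω Q P) a d) ℚ.+
    (ℚ.- mixedDiff (ω P Q) b c ℚ.+ ℚ.- (ℚ.- mixedDiff (ω P P) b d))
    ≡ mixedDiff (ω Q P) b c ℚ.- mixedDiff (ω Q P) a d
  ratio-coefficient a b c d = begin
    (mixedDiff (ω Q Q) a c ℚ.+ ℚ.- Y) ℚ.+ (ℚ.- mixedDiff (ω P Q) b c ℚ.+ ℚ.- (ℚ.- mixedDiff (ω P P) b d))
      ≡⟨ cong₂ (λ u v → (u ℚ.+ ℚ.- Y) ℚ.+ v) (mixedDiff-cong pad-0 a c)
               (cong₂ (λ u v → ℚ.- u ℚ.+ ℚ.- (ℚ.- v)) PQ (mixedDiff-cong pad-0 b d)) ⟩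
    (0ℚ ℚ.+ ℚ.- Y) ℚ.+ (ℚ.- (ℚ.- X) ℚ.+ ℚ.- (ℚ.- 0ℚ))
      ≡⟨ identity X Y ⟩
    X ℚ.- Y ∎
    where
    open ≡-Reasoning
    X Y : ℚ
    X = mixedDiff (ω Q P) b c
    Y = mixedDiff (ω Q P) a d
    PQ : mixedDiff (ω P Q) b c ≡ ℚ.- X
    PQ = trans (mixedDiff-cong (pad-neg Cinv) b c) (mixedDiff-neg (pad Cinv) b c)
    identity : ∀ x y → (0ℚ ℚ.+ ℚ.- y) ℚ.+ (ℚ.- (ℚ.- x) ℚ.+ ℚ.- (ℚ.- 0ℚ)) ≡ x ℚ.- y
    identity = solve-∀ ℚ-ring

module Brackets {c ℓ : Level} {r : ℕ} {Cinv : Fin r → Fin r → ℚ} {R : CommutativeRing c ℓ}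
                (lc : LogCanonical r Cinv R) where
  open CommutativeRing R renaming (refl to ≈-refl; sym to ≈-sym; trans to ≈-trans)
  open LogCanonical lc
  open IsRingHomomorphism ι-hom using (0#-homo; 1#-homo; -‿homo; +-homo; *-homo)
  open import Algebra.Properties.Group +-group using (identityʳ-unique; inverseˡ-unique)
  open import Algebra.Properties.Ring ring using (-1*x≈-x)
  open import Algebra.Properties.CommutativeSemigroup *-commutativeSemigroup using (interchange)
  open import Relation.Binary.Reasoning.Setoid setoid

  private
    ι-morphism : ℚ.+-*-rawRing -Raw-AlmostCommutative⟶ fromCommutativeRing R
    ι-morphism = record
      { ⟦_⟧ = ι ; +-homo = +-homo ; *-homo = *-homo ; -‿homo = -‿homo
      ; 0-homo = 0#-homo ; 1-homo = 1#-homo }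

    ι-coefficients≟ : WeaklyDecidable (Induced-equivalence ι-morphism)
    ι-coefficients≟ s t with s ℚ.≟ t
    ... | yes refl = just ≈-refl
    ... | no _     = nothing

    open Algebra.Solver.Ring ℚ.+-*-rawRing (fromCommutativeRing R) ι-morphism ι-coefficients≟
      using (solve; _:=_; _:+_; _:*_; :-_)

    negate-swap : ∀ a x y → - (a * (x * y)) ≈ (- a) * (y * x)
    negate-swap = solve 3 (λ a x y → :- (a :* (x :* y)) := (:- a) :* (y :* x)) ≈-refl

    leibniz-collect : ∀ x y z a b → x * (b * (y * z)) + a * (x * z) * y ≈ (a + b) * (x * y * z)
    leibniz-collect = solve 5 (λ x y z a b →
      x :* (b :* (y :* z)) :+ a :* (x :* z) :* y := (a :+ b) :* (x :* y :* z)) ≈-refl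

    reassoc : ∀ x x′ w → x * x′ * w ≈ x′ * (x * w)
    reassoc = solve 3 (λ x x′ w → x :* x′ :* w := x′ :* (x :* w)) ≈-refl

    cross : ∀ a b c d → a * b * (c * d) ≈ a * d * (c * b)
    cross = solve 4 (λ a b c d → a :* b :* (c :* d) := a :* d :* (c :* b)) ≈-refl

    inverse-rearrange : ∀ x x′ z a → x′ * - (a * (x * z) * x′) ≈ (- a) * (x * x′ * (x′ * z))
    inverse-rearrange = solve 4 (λ x x′ z a →
      x′ :* (:- (a :* (x :* z) :* x′)) := (:- a) :* (x :* x′ :* (x′ :* z))) ≈-refl

  LogCan : Carrier → Carrier → ℚ → Set ℓ
  LogCan x y t = ⟦ x , y ⟧ ≈ ι t * (x * y)

  logCan-coeff : ∀ {x y s t} → s ≡ t → LogCan x y s → LogCan x y t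
  logCan-coeff refl h = h

  logCan-resp : ∀ {x x′ y y′ t} → x ≈ x′ → y ≈ y′ → LogCan x y t → LogCan x′ y′ t
  logCan-resp x≈x′ y≈y′ h =
    ≈-trans (cong-br (≈-sym x≈x′) (≈-sym y≈y′)) (≈-trans h (*-congˡ (*-cong x≈x′ y≈y′)))

  bracket-1ˡ : ∀ z → ⟦ 1# , z ⟧ ≈ 0#
  bracket-1ˡ z = identityʳ-unique u u (begin
    u + u                      ≈⟨ +-cong (*-identityˡ u) (*-identityʳ u) ⟨
    1# * u + u * 1#            ≈⟨ leibnizˡ 1# 1# z ⟨
    ⟦ 1# * 1# , z ⟧            ≈⟨ cong-br (*-identityˡ 1#) ≈-refl ⟩
    u                          ∎)
    where
    u : Carrier
    u = ⟦ 1# , z ⟧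

  logCan-1ˡ : ∀ z → LogCan 1# z 0ℚ
  logCan-1ˡ z = ≈-trans (bracket-1ˡ z) (≈-sym (≈-trans (*-congʳ 0#-homo) (zeroˡ _)))

  logCan-swap : ∀ {x y t} → LogCan x y t → LogCan y x (ℚ.- t)
  logCan-swap {x} {y} {t} h = begin
    ⟦ y , x ⟧                ≈⟨ antisym y x ⟩
    - ⟦ x , y ⟧              ≈⟨ -‿cong h ⟩
    - (ι t * (x * y))        ≈⟨ negate-swap (ι t) x y ⟩
    (- ι t) * (y * x)        ≈⟨ *-congʳ (-‿homo t) ⟨
    ι (ℚ.- t) * (y * x)      ∎

  logCan-1ʳ : ∀ x → LogCan x 1# 0ℚ
  logCan-1ʳ x = logCan-swap (logCan-1ˡ x)

  logCan-*ˡ : ∀ {x y z s t} → LogCan x z s → LogCan y z t → LogCan (x * y) z (s ℚ.+ t)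
  logCan-*ˡ {x} {y} {z} {s} {t} hx hy = begin
    ⟦ x * y , z ⟧                              ≈⟨ leibnizˡ x y z ⟩
    x * ⟦ y , z ⟧ + ⟦ x , z ⟧ * y              ≈⟨ +-cong (*-congˡ hy) (*-congʳ hx) ⟩
    x * (ι t * (y * z)) + ι s * (x * z) * y    ≈⟨ leibniz-collect x y z (ι s) (ι t) ⟩
    (ι s + ι t) * (x * y * z)                  ≈⟨ *-congʳ (+-homo s t) ⟨
    ι (s ℚ.+ t) * (x * y * z)                  ∎

  logCan-*ʳ : ∀ {x y z s t} → LogCan x y s → LogCan x z t → LogCan x (y * z) (s ℚ.+ t)
  logCan-*ʳ {s = s} {t} hy hz =
    logCan-coeff (negate-sum s t) (logCan-swap (logCan-*ˡ (logCan-swap hy) (logCan-swap hz)))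
    where
    negate-sum : ∀ s t → ℚ.- (ℚ.- s ℚ.+ ℚ.- t) ≡ s ℚ.+ t
    negate-sum = solve-∀ ℚ-ring

  logCan-invˡ : ∀ {x x′ z s} → x * x′ ≈ 1# → LogCan x z s → LogCan x′ z (ℚ.- s)
  logCan-invˡ {x} {x′} {z} {s} xx′≈1 hx = begin
    w                                      ≈⟨ *-identityˡ w ⟨
    1# * w                                 ≈⟨ *-congʳ xx′≈1 ⟨
    x * x′ * w                             ≈⟨ reassoc x x′ w ⟩
    x′ * (x * w)                           ≈⟨ *-congˡ x·w ⟩
    x′ * - (⟦ x , z ⟧ * x′)                 ≈⟨ *-congˡ (-‿cong (*-congʳ hx)) ⟩
    x′ * - (ι s * (x * z) * x′)             ≈⟨ inverse-rearrange x x′ z (ι s) ⟩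
    (- ι s) * (x * x′ * (x′ * z))           ≈⟨ *-cong (-‿homo s) (*-congʳ (≈-sym xx′≈1)) ⟨
    ι (ℚ.- s) * (1# * (x′ * z))             ≈⟨ *-congˡ (*-identityˡ (x′ * z)) ⟩
    ι (ℚ.- s) * (x′ * z)                    ∎
    where
    w : Carrier
    w = ⟦ x′ , z ⟧
    x·w : x * w ≈ - (⟦ x , z ⟧ * x′)
    x·w = inverseˡ-unique (x * w) (⟦ x , z ⟧ * x′)
            (≈-trans (≈-sym (leibnizˡ x x′ z)) (≈-trans (cong-br xx′≈1 ≈-refl) (bracket-1ˡ z)))

  logCan-invʳ : ∀ {x z z′ s} → z * z′ ≈ 1# → LogCan x z s → LogCan x z′ (ℚ.- s)
  logCan-invʳ {s = s} zz′≈1 h =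
    logCan-coeff (triple-negation s) (logCan-swap (logCan-invˡ zz′≈1 (logCan-swap h)))
    where
    triple-negation : ∀ s → ℚ.- (ℚ.- (ℚ.- s)) ≡ ℚ.- s
    triple-negation = solve-∀ ℚ-ring

  logCan-one : ∀ {x y} → LogCan x y 1ℚ → ⟦ x , y ⟧ ≈ x * y
  logCan-one h = ≈-trans h (≈-trans (*-congʳ 1#-homo) (*-identityˡ _))

  logCan-zero : ∀ {x y} → LogCan x y 0ℚ → ⟦ x , y ⟧ ≈ 0#
  logCan-zero h = ≈-trans h (≈-trans (*-congʳ 0#-homo) (zeroˡ _))

  logCan-minusOne : ∀ {x y} → LogCan x y (ℚ.- 1ℚ) → ⟦ x , y ⟧ ≈ - (x * y)
  logCan-minusOne h =
    ≈-trans h (≈-trans (*-congʳ (≈-trans (-‿homo 1ℚ) (-‿cong 1#-homo))) (-1*x≈-x _))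

  open Padding r
  open Coefficients Cinv

  gen gen⁻¹ : Kind → ℕ → Carrier
  gen Q = q
  gen P = p
  gen⁻¹ Q = q⁻¹
  gen⁻¹ P = p⁻¹

  gen-slot : ∀ k x → gen k x ≡ maybe (A ∘ place k) 1# (slot x)
  gen-slot Q zero = refl
  gen-slot P zero = refl
  gen-slot Q (suc a) with a ℕ.<? r
  ... | yes _ = refl
  ... | no _  = refl
  gen-slot P (suc a) with a ℕ.<? r
  ... | yes _ = refl
  ... | no _  = refl

  gen⁻¹-slot : ∀ k x → gen⁻¹ k x ≡ maybe (A⁻¹ ∘ place k) 1# (slot x)
  gen⁻¹-slot Q zero = refl
  gen⁻¹-slot P zero = refl
  gen⁻¹-slot Q (suc a) with a ℕ.<? r
  ... | yes _ = refl
  ... | no _  = refl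
  gen⁻¹-slot P (suc a) with a ℕ.<? r
  ... | yes _ = refl
  ... | no _  = refl

  gen-inverse : ∀ k x → gen k x * gen⁻¹ k x ≈ 1#
  gen-inverse k x rewrite gen-slot k x | gen⁻¹-slot k x with slot x
  ... | nothing = *-identityˡ 1#
  ... | just i  = A-inv (place k i)

  gen-bracket : ∀ k k′ x y → LogCan (gen k x) (gen k′ y) (ω k k′ x y)
  gen-bracket k k′ x y rewrite gen-slot k x | gen-slot k′ y with slot x | slot y
  ... | nothing | _       = logCan-1ˡ _
  ... | just _  | nothing = logCan-1ʳ _
  ... | just i  | just j  = logCan-coeff (Ω-block k k′ i j) (A-bracket (place k i) (place k′ j))

  ratio ratio⁻¹ : Kind → ℕ → Carrier
  ratio k m = gen k m * gen⁻¹ k (suc m)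
  ratio⁻¹ k m = gen k (suc m) * gen⁻¹ k m

  ratio-inverse : ∀ k m → ratio k m * ratio⁻¹ k m ≈ 1#
  ratio-inverse k m = begin
    gen k m * gen⁻¹ k (suc m) * (gen k (suc m) * gen⁻¹ k m)  ≈⟨ cross _ _ _ _ ⟩
    gen k m * gen⁻¹ k m * (gen k (suc m) * gen⁻¹ k (suc m))
      ≈⟨ *-cong (gen-inverse k m) (gen-inverse k (suc m)) ⟩
    1# * 1#                                                  ≈⟨ *-identityˡ 1# ⟩
    1#                                                       ∎

  ratio-bracket : ∀ k k′ m n → LogCan (ratio k m) (ratio k′ n) (mixedDiff (ω k k′) m n)
  ratio-bracket k k′ m n = logCan-*ˡ (row m) (logCan-invˡ (gen-inverse k (suc m)) (row (suc m)))
    where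
    row : ∀ x → LogCan (gen k x) (ratio k′ n) (ω k k′ x n ℚ.- ω k k′ x (suc n))
    row x = logCan-*ʳ (gen-bracket k k′ x n)
                      (logCan-invʳ (gen-inverse k′ (suc n)) (gen-bracket k k′ x (suc n)))

  ratio-product-bracket : ∀ a b c d →
    LogCan (ratio Q a * ratio⁻¹ P b) (ratio Q c * ratio⁻¹ P d)
           (mixedDiff (ω Q P) b c ℚ.- mixedDiff (ω Q P) a d)
  ratio-product-bracket a b c d = logCan-coeff (ratio-coefficient a b c d)
    (logCan-*ˡ (logCan-*ʳ QQ QP) (logCan-*ʳ PQ PP))
    where
    QQ : LogCan (ratio Q a) (ratio Q c) (mixedDiff (ω Q Q) a c)
    QQ = ratio-bracket Q Q a c
    QP : LogCan (ratio Q a) (ratio⁻¹ P d) (ℚ.- mixedDiff (ω Q P) a d)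
    QP = logCan-invʳ (ratio-inverse P d) (ratio-bracket Q P a d)
    PQ : LogCan (ratio⁻¹ P b) (ratio Q c) (ℚ.- mixedDiff (ω P Q) b c)
    PQ = logCan-invˡ (ratio-inverse P b) (ratio-bracket P Q b c)
    PP : LogCan (ratio⁻¹ P b) (ratio⁻¹ P d) (ℚ.- (ℚ.- mixedDiff (ω P P) b d))
    PP = logCan-invˡ (ratio-inverse P b) (logCan-invʳ (ratio-inverse P d) (ratio-bracket P P b d))

  ⌈/2⌉-even : ∀ n → isEven n ≡ true → ⌈ n /2⌉ ≡ ⌊ n /2⌋
  ⌈/2⌉-even zero          _    = refl
  ⌈/2⌉-even (suc zero)    ()
  ⌈/2⌉-even (suc (suc n)) even = cong suc (⌈/2⌉-even n even)

  ⌈/2⌉-odd : ∀ n → isEven n ≡ false → ⌈ n /2⌉ ≡ suc ⌊ n /2⌋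
  ⌈/2⌉-odd zero          ()
  ⌈/2⌉-odd (suc zero)    _   = refl
  ⌈/2⌉-odd (suc (suc n)) odd = cong suc (⌈/2⌉-odd n odd)

  -- γ_{2a-1} = Q_a / P_a and γ_{2a} = Q_a / P_{a+1}, with Q_a = ratio Q (a - 1),
  -- 1 / P_b = ratio⁻¹ P (b - 1) and a = ⌊ k /2⌋ + 1.
  γ-ratios : ∀ k → γ (suc k) ≈ ratio Q ⌊ k /2⌋ * ratio⁻¹ P ⌈ k /2⌉
  γ-ratios k with isEven k in parity
  ... | true  rewrite ⌈/2⌉-even k parity = interchange _ _ _ _
  ... | false rewrite ⌈/2⌉-odd k parity  = interchange _ _ _ _

  γ-bracket : IsInverseOfC r Cinv →
              ∀ {i j} → 1 ≤ i → i ≤ 2 ℕ.* r ℕ.+ 1 → 1 ≤ j → j ≤ 2 ℕ.* r ℕ.+ 1 →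
              LogCan (γ i) (γ j) (ε i j)
  γ-bracket inv {suc k} {suc l} _ i≤ _ j≤ =
    logCan-resp (≈-sym (γ-ratios k)) (≈-sym (γ-ratios l))
      (logCan-coeff
        (mixedDiff-M-δ (⌊/2⌋-≤ (ℕP.<⇒≤ i≤)) (⌊/2⌋-≤ i≤) (⌊/2⌋-≤ (ℕP.<⇒≤ j≤)) (⌊/2⌋-≤ j≤))
        (ratio-product-bracket ⌊ k /2⌋ ⌈ k /2⌉ ⌊ l /2⌋ ⌈ l /2⌉))
    where open CartanInverse Cinv inv

proposition5p7 : ∀ {c ℓ : Level} (r : ℕ) → 1 ≤ r →
    (Cinv : Fin r → Fin r → ℚ) → IsInverseOfC r Cinv →
    (R : CommutativeRing c ℓ) → (P : LogCanonical r Cinv R) →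
    let open CommutativeRing R
        open LogCanonical P
    in ∀ (i j : ℕ) → 1 ≤ i → i ≤ 2 ℕ.* r ℕ.+ 1 → 1 ≤ j → j ≤ 2 ℕ.* r ℕ.+ 1 →
       (i < j → Adj r i j → ⟦ γ i , γ j ⟧ ≈ γ i * γ j) ×
       (j < i → Adj r i j → ⟦ γ i , γ j ⟧ ≈ - (γ i * γ j)) ×
       (¬ (i < j × Adj r i j) → ¬ (j < i × Adj r i j) → ⟦ γ i , γ j ⟧ ≈ 0#)
proposition5p7 r _ Cinv inv R lc i j 1≤i i≤ 1≤j j≤ = forward , backward , neither
  where
  open CommutativeRing R using (_≈_; _*_; -_; 0#)
  open LogCanonical lc using (⟦_,_⟧; γ)
  open Brackets lc
  bracket : LogCan (γ i) (γ j) (ε i j)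
  bracket = γ-bracket inv 1≤i i≤ 1≤j j≤
  forward : i < j → Adj r i j → ⟦ γ i , γ j ⟧ ≈ γ i * γ j
  forward _   (inj₁ e) = logCan-one (logCan-coeff (ε-edge e) bracket)
  forward i<j (inj₂ e) = contradiction (edge-< e) (ℕP.<-asym i<j)
  backward : j < i → Adj r i j → ⟦ γ i , γ j ⟧ ≈ - (γ i * γ j)
  backward _   (inj₂ e) =
    logCan-minusOne (logCan-coeff (cong ℚ.-_ (ε-edge e)) (logCan-swap (γ-bracket inv 1≤j j≤ 1≤i i≤)))
  backward j<i (inj₁ e) = contradiction (edge-< e) (ℕP.<-asym j<i)
  neither : ¬ (i < j × Adj r i j) → ¬ (j < i × Adj r i j) → ⟦ γ i , γ j ⟧ ≈ 0#
  neither ¬ij ¬ji = logCan-zero (logCan-coeff (ε-nonadjacent 1≤i i≤ 1≤j j≤ ¬adj) bracket)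
    where
    ¬adj : ¬ Adj r i j
    ¬adj (inj₁ e) = ¬ij (edge-< e , inj₁ e)
    ¬adj (inj₂ e) = ¬ji (edge-< e , inj₂ e)
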